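{- If $G$ is a connected triangle-free graph of order $n\ge 2$, then $$\chi_{\mu_i}(G)\le \left\lceil \frac{n-\mu_i(G)}{2}\right\rceil+1.$$ Moreover, this bound is sharp: there exist connected triangle-free graphs attaining equality.
   Context: All graphs are finite and simple. A geodesic is a shortest path. For $X\subseteq V(G)$, two vertices $x,y\in X$ are $X$-visible if some $x,y$-geodesic has no internal vertex in $X$. $X$ is an independent mutual-visibility (IMV) set if $X$ is independent and every two vertices of $X$ are $X$-visible. $\mu_i(G)$ is the maximum cardinality of an IMV set of $G$. $\chi_{\mu_i}(G)$ is the least $k$ such that $V(G)$ can be partitioned into $k$ IMV sets (equivalently, the least $k$ for which there is a map $c:V(G)\to[k]$ all of whose color classes are IMV sets). -}

module Defs where

open import Data.Nat using (ℕ; zero; suc; _≤_)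
open import Data.Bool using (Bool; true; false)
open import Data.Fin using (Fin; _≟_)
open import Data.Fin.Subset using (Subset; _∈_; _∉_; ∣_∣)
open import Data.Vec using (tabulate)
open import Data.List using (List; []; _∷_)
open import Data.List.Relation.Unary.All using (All)
open import Data.Product using (Σ; _×_; ∃; ∃-syntax)
open import Relation.Nullary using (¬_; ⌊_⌋)
open import Relation.Binary.PropositionalEquality using (_≡_; _≢_)

record Graph (n : ℕ) : Set where
  field
    adj   : Fin n → Fin n → Bool
    sym   : ∀ x y → adj x y ≡ adj y x
    irrefl : ∀ x → adj x x ≡ false
open Graph public

module _ {n : ℕ} (G : Graph n) where

  data Walk : Fin n → Fin n → Set where
    [] : ∀ {x} → Walk x x
    _∷_ : ∀ {x y z} → adj G x y ≡ true → Walk y z → Walk x z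

  len : ∀ {x y} → Walk x y → ℕ
  len [] = 0
  len (_ ∷ w) = suc (len w)

  inner : ∀ {x y} → Walk x y → List (Fin n)
  inner [] = []
  inner (_ ∷ []) = []
  inner (_∷_ {y = y} _ (e ∷ w)) = y ∷ inner (e ∷ w)

  IsGeodesic : ∀ {x y} → Walk x y → Set
  IsGeodesic {x} {y} w = ∀ (w' : Walk x y) → len w ≤ len w'

  Connected : Set
  Connected = ∀ x y → Walk x y

  TriangleFree : Set
  TriangleFree = ∀ x y z → adj G x y ≡ true → adj G y z ≡ true → adj G x z ≡ true → Data.Empty.⊥
    where import Data.Empty

  Visible : Subset n → Fin n → Fin n → Set
  Visible X x y = Σ (Walk x y) λ w → IsGeodesic w × All (λ v → v ∉ X) (inner w)

  Independent : Subset n → Set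
  Independent X = ∀ x y → x ∈ X → y ∈ X → adj G x y ≡ false

  IsIMV : Subset n → Set
  IsIMV X = Independent X × (∀ x y → x ∈ X → y ∈ X → x ≢ y → Visible X x y)

  IsMuI : ℕ → Set
  IsMuI m = (∃[ X ] (IsIMV X × ∣ X ∣ ≡ m)) × (∀ X → IsIMV X → ∣ X ∣ ≤ m)

  colourClass : ∀ {k} → (Fin n → Fin k) → Fin k → Subset n
  colourClass c i = tabulate (λ v → ⌊ c v ≟ i ⌋)

  IsIMVColouring : (k : ℕ) → (Fin n → Fin k) → Set
  IsIMVColouring k c = ∀ i → IsIMV (colourClass c i)

  IsChiMuI : ℕ → Set
  IsChiMuI k = (∃[ c ] IsIMVColouring k c)
             × (∀ k' (c : Fin n → Fin k') → IsIMVColouring k' c → k ≤ k')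

{-# OPTIONS --safe #-}
-- Colour a maximum IMV set X with one colour and split the r = n − μᵢ remaining vertices
-- into ⌈r/2⌉ further IMV sets. In a connected graph two non-adjacent vertices form an IMV
-- set (no inner vertex of a geodesic is an endpoint), and in a triangle-free graph every
-- neighbourhood N(u) is one (two neighbours of u see each other through u). Among three
-- vertices two are non-adjacent, so non-adjacent pairs can be split off until at most four
-- vertices are left; four are covered by two pairs or by N(u) and {u}. The only exception is
-- r = 2 with the two remaining vertices x ~ y adjacent: as X is independent and G connected,
-- every vertex has a neighbour in {x, y}, so N(x) and N(y) cover the whole graph.
-- Equality holds for K₂, where μᵢ = 1 and two colours are needed.
module Submission where

open import Defs
open import Data.Nat using (ℕ; _≤_; _+_; _∸_; ⌈_/2⌉)
open import Data.Product using (Σ; _×_; ∃-syntax)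
open import Relation.Binary.PropositionalEquality using (_≡_)

open import Data.Bool using (Bool; true; false)
import Data.Bool as Bool
open import Data.Bool.Properties using (T-≡)
open import Data.Empty using (⊥-elim)
open import Data.Fin using (Fin; zero; suc; _≟_)
open import Data.Fin.Properties using (any?)
open import Data.Fin.Subset using (Subset; _∈_; _∉_; inside; outside; ∁; ⁅_⁆; ∣_∣)
open import Data.Fin.Subset.Properties using (_∈?_; x∉p⇒x∈∁p; x∈∁p⇒x∉p; ∣∁p∣≡n∸∣p∣; x∈⁅y⁆⇒x≡y)
open import Data.List using (List; []; _∷_; [_]; length; map)
open import Data.List.Properties using (length-map)
open import Data.List.Membership.Propositional using () renaming (_∈_ to _∈ₗ_)
open import Data.List.Membership.Propositional.Properties using (∈-map⁺; ∈-map⁻; ∈-++⁻)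
open import Data.List.Relation.Binary.Permutation.Propositional
  using (_↭_; ↭-refl; prep; swap) renaming (trans to ↭-trans)
open import Data.List.Relation.Binary.Permutation.Propositional.Properties using (∈-resp-↭; ++⁺ʳ)
import Data.List.Relation.Unary.All as All
open import Data.List.Relation.Unary.Any using (here; there)
open import Data.Nat using (zero; suc; _<_; z≤n; s≤s)
open import Data.Nat.Induction using (<-wellFounded)
open import Data.Nat.Properties
  using (≤-refl; ≮⇒≥; <⇒≱; n<1+n; m<n⇒m<1+n; anyUpTo?; suc-injective; +-comm; module ≤-Reasoning)
open import Data.Product using (_,_; proj₁; proj₂; ∃)
open import Data.Sum using (_⊎_; inj₁; inj₂; [_,_]′; map₂)
open import Data.Vec using (_∷_; [])
import Data.Vec as Vec
open import Data.Vec.Properties using (lookup∘tabulate; []=⇒lookup; lookup⇒[]=)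
open import Function using (_∘_; Equivalence)
open import Induction.WellFounded using (Acc; acc)
open import Level using (0ℓ)
open import Relation.Binary.PropositionalEquality using (refl; trans; cong; subst; _≢_)
import Relation.Binary.PropositionalEquality as ≡
open import Relation.Nullary using (¬_; Dec; yes; no; contradiction)
open import Relation.Nullary.Decidable using (map′; _×-dec_; toWitness; fromWitness)
open import Relation.Unary using (Pred; _⊆_; _∪_; U)

private variable
  n : ℕ

elements : Subset n → List (Fin n)
elements []            = []
elements (inside  ∷ p) = zero ∷ map suc (elements p)
elements (outside ∷ p) = map suc (elements p)

length-elements : ∀ (p : Subset n) → length (elements p) ≡ ∣ p ∣
length-elements []            = refl
length-elements (inside  ∷ p) = cong suc (trans (length-map suc (elements p)) (length-elements p))
length-elements (outside ∷ p) = trans (length-map suc (elements p)) (length-elements p)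

∈⇒∈-elements : ∀ {p : Subset n} {x} → x ∈ p → x ∈ₗ elements p
∈⇒∈-elements {p = inside  ∷ _} Vec.here          = here refl
∈⇒∈-elements {p = inside  ∷ _} (Vec.there x∈p) = there (∈-map⁺ suc (∈⇒∈-elements x∈p))
∈⇒∈-elements {p = outside ∷ _} (Vec.there x∈p) = ∈-map⁺ suc (∈⇒∈-elements x∈p)

∈-elements⇒∈ : ∀ {p : Subset n} {x} → x ∈ₗ elements p → x ∈ p
∈-elements⇒∈ {p = inside  ∷ _} (here refl) = Vec.here
∈-elements⇒∈ {p = inside  ∷ _} (there x∈)  with ∈-map⁻ suc x∈
... | _ , y∈ , refl = Vec.there (∈-elements⇒∈ y∈)
∈-elements⇒∈ {p = outside ∷ _} x∈          with ∈-map⁻ suc x∈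
... | _ , y∈ , refl = Vec.there (∈-elements⇒∈ y∈)

distinct⇒2≤ : ∀ {k} {i j : Fin k} → i ≢ j → 2 ≤ k
distinct⇒2≤ {suc (suc _)}                _   = s≤s (s≤s z≤n)
distinct⇒2≤ {suc zero}    {zero} {zero} i≢j = contradiction refl i≢j

∈-pair-pigeonhole : ∀ {A : Set} {a b x y z : A} →
  x ∈ₗ a ∷ b ∷ [] → y ∈ₗ a ∷ b ∷ [] → z ∈ₗ a ∷ b ∷ [] → x ≡ y ⊎ z ≡ x ⊎ z ≡ y
∈-pair-pigeonhole (here refl)         (here refl)         _                   = inj₁ refl
∈-pair-pigeonhole (there (here refl)) (there (here refl)) _                   = inj₁ refl
∈-pair-pigeonhole (here refl)         _                   (here refl)         = inj₂ (inj₁ refl)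
∈-pair-pigeonhole (there (here refl)) _                   (there (here refl)) = inj₂ (inj₁ refl)
∈-pair-pigeonhole _                   (here refl)         (here refl)         = inj₂ (inj₂ refl)
∈-pair-pigeonhole _                   (there (here refl)) (there (here refl)) = inj₂ (inj₂ refl)

module _ (G : Graph n) where

  Adj : Fin n → Fin n → Set
  Adj x y = adj G x y ≡ true

  adj-sym : ∀ {x y} → Adj x y → Adj y x
  adj-sym {x} {y} xy = trans (sym G y x) xy

  ≡false⇒¬Adj : ∀ {x y} → adj G x y ≡ false → ¬ Adj x y
  ≡false⇒¬Adj x≁y xy with () ← trans (≡.sym xy) x≁y

  WalkOfLength : ℕ → Fin n → Fin n → Set
  WalkOfLength ℓ x y = ∃[ w ] len G {x} {y} w ≡ ℓ

  walkOfLength? : ∀ ℓ x y → Dec (WalkOfLength ℓ x y)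
  walkOfLength? zero x y with x ≟ y
  ... | yes refl = yes ([] , refl)
  ... | no x≢y = no λ { ([] , _) → x≢y refl }
  walkOfLength? (suc ℓ) x y =
    map′ (λ { (_ , xz , w , refl) → xz ∷ w , refl })
         (λ { (_∷_ {y = z} xz w , len≡) → z , xz , w , suc-injective len≡ })
         (any? λ z → (adj G x z Bool.≟ true) ×-dec walkOfLength? ℓ z y)

  shortenToGeodesic : ∀ {x y} (w : Walk G x y) → Acc _<_ (len G w) → ∃ (IsGeodesic G {x} {y})
  shortenToGeodesic {x} {y} w (acc shorter)
    with anyUpTo? (λ ℓ → walkOfLength? ℓ x y) (len G w)
  ... | yes (_ , w′<w , w′ , refl) = shortenToGeodesic w′ (shorter w′<w)
  ... | no ∄shorter = w , λ w′ → ≮⇒≥ λ w′<w → ∄shorter (len G w′ , w′<w , w′ , refl)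

  geodesic : ∀ {x y} → Walk G x y → ∃ (IsGeodesic G {x} {y})
  geodesic w = shortenToGeodesic w (<-wellFounded (len G w))

  splitAtInner : ∀ {x y v} (w : Walk G x y) → v ∈ₗ inner G w →
                 ∃[ w₁ ] ∃[ w₂ ] len G {x} {v} w₁ < len G w × len G {v} {y} w₂ < len G w
  splitAtInner (xz ∷ (zy ∷ w)) (here refl) = xz ∷ [] , zy ∷ w , s≤s (s≤s z≤n) , n<1+n _
  splitAtInner (xz ∷ (zy ∷ w)) (there v∈w) with splitAtInner (zy ∷ w) v∈w
  ... | w₁ , w₂ , w₁< , w₂< = xz ∷ w₁ , w₂ , s≤s w₁< , m<n⇒m<1+n w₂<

  geodesic-inner-≢ : ∀ {x y v} (w : Walk G x y) → IsGeodesic G w → v ∈ₗ inner G w → v ≢ x × v ≢ y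
  geodesic-inner-≢ w geo v∈w with splitAtInner w v∈w
  ... | w₁ , w₂ , w₁< , w₂< = (λ { refl → <⇒≱ w₂< (geo w₂) }) , (λ { refl → <⇒≱ w₁< (geo w₁) })

  Visibleᵖ : Pred (Fin n) 0ℓ → Fin n → Fin n → Set
  Visibleᵖ P x y = Σ (Walk G x y) λ w → IsGeodesic G w × All.All (λ v → ¬ P v) (inner G w)

  -- For X : Subset n, IsIMV G X unfolds to IsIMVᵖ (_∈ X).
  IsIMVᵖ : Pred (Fin n) 0ℓ → Set
  IsIMVᵖ P = (∀ x y → P x → P y → adj G x y ≡ false)
           × (∀ x y → P x → P y → x ≢ y → Visibleᵖ P x y)

  IsIMVᵖ-⊆ : ∀ {P Q} → P ⊆ Q → IsIMVᵖ Q → IsIMVᵖ P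
  IsIMVᵖ-⊆ P⊆Q (independent , visible) =
    (λ x y Px Py → independent x y (P⊆Q Px) (P⊆Q Py)) ,
    λ x y Px Py x≢y → let (w , geo , avoids) = visible x y (P⊆Q Px) (P⊆Q Py) x≢y
                      in w , geo , All.map (_∘ P⊆Q) avoids

  singleton-isIMV : ∀ a → IsIMVᵖ (_∈ₗ [ a ])
  singleton-isIMV a =
    (λ { x y (here refl) (here refl) → irrefl G a }) ,
    (λ { x y (here refl) (here refl) x≢y → contradiction refl x≢y })

  pair-isIMV : Connected G → ∀ {a b} → adj G a b ≡ false → IsIMVᵖ (_∈ₗ a ∷ b ∷ [])
  pair-isIMV connected {a} {b} a≁b = independent , visible
    where
    independent : ∀ x y → x ∈ₗ a ∷ b ∷ [] → y ∈ₗ a ∷ b ∷ [] → adj G x y ≡ false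
    independent x y (here refl)         (here refl)         = irrefl G a
    independent x y (here refl)         (there (here refl)) = a≁b
    independent x y (there (here refl)) (here refl)         = trans (sym G b a) a≁b
    independent x y (there (here refl)) (there (here refl)) = irrefl G b

    visible : ∀ x y → x ∈ₗ a ∷ b ∷ [] → y ∈ₗ a ∷ b ∷ [] → x ≢ y → Visibleᵖ (_∈ₗ a ∷ b ∷ []) x y
    visible x y x∈ y∈ x≢y =
      let (w , geo) = geodesic (connected x y) in
      w , geo , All.tabulate λ {v} v∈w v∈ →
        let (v≢x , v≢y) = geodesic-inner-≢ w geo v∈w in
        [ x≢y , [ v≢x , v≢y ]′ ]′ (∈-pair-pigeonhole x∈ y∈ v∈)

  Nbhd : Fin n → Pred (Fin n) 0ℓ
  Nbhd u v = Adj v u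

  nbhd-isIMV : TriangleFree G → ∀ u → IsIMVᵖ (Nbhd u)
  nbhd-isIMV triangleFree u = independent , visible
    where
    independent : ∀ x y → Adj x u → Adj y u → adj G x y ≡ false
    independent x y xu yu with adj G x y in xy
    ... | true  = ⊥-elim (triangleFree x y u xy yu xu)
    ... | false = refl

    visible : ∀ x y → Adj x u → Adj y u → x ≢ y → Visibleᵖ (Nbhd u) x y
    visible x y xu yu x≢y = xu ∷ (adj-sym yu ∷ []) , geo , ≡false⇒¬Adj (irrefl G u) All.∷ All.[]
      where
      geo : IsGeodesic G (xu ∷ (adj-sym yu ∷ []))
      geo []            = contradiction refl x≢y
      geo (xy ∷ [])     = contradiction xy (≡false⇒¬Adj (independent x y xu yu))
      geo (_ ∷ (_ ∷ _)) = s≤s (s≤s z≤n)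

  -- Blocks may overlap: IMV sets are closed under subsets, so a cover of U still yields a colouring.
  record IMVCover (P : Pred (Fin n) 0ℓ) (K : ℕ) : Set₁ where
    field
      block     : Fin K → Pred (Fin n) 0ℓ
      block-IMV : ∀ i → IsIMVᵖ (block i)
      covered   : P ⊆ λ v → ∃[ i ] block i v
  open IMVCover

  IMVCover-⊆ : ∀ {P Q K} → Q ⊆ P → IMVCover P K → IMVCover Q K
  IMVCover-⊆ Q⊆P C = record { block = block C ; block-IMV = block-IMV C ; covered = covered C ∘ Q⊆P }

  IMVCover-↭ : ∀ {xs ys K} → xs ↭ ys → IMVCover (_∈ₗ ys) K → IMVCover (_∈ₗ xs) K
  IMVCover-↭ xs↭ys = IMVCover-⊆ (∈-resp-↭ xs↭ys)

  []ᶜ : IMVCover (_∈ₗ []) 0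
  []ᶜ = record { block = λ () ; block-IMV = λ () ; covered = λ () }

  _∷ᶜ_ : ∀ {S P K} → IsIMVᵖ S → IMVCover P K → IMVCover (S ∪ P) (suc K)
  _∷ᶜ_ {S} S-IMV C = record
    { block     = λ { zero → S ; (suc i) → block C i }
    ; block-IMV = λ { zero → S-IMV ; (suc i) → block-IMV C i }
    ; covered   = λ { (inj₁ v∈S) → zero , v∈S ; (inj₂ v∈P) → let (i , v∈i) = covered C v∈P in suc i , v∈i }
    }
  infixr 5 _∷ᶜ_

  singletonᶜ : ∀ a → IMVCover (_∈ₗ [ a ]) 1
  singletonᶜ a = IMVCover-⊆ (∈-++⁻ [ a ]) (singleton-isIMV a ∷ᶜ []ᶜ)

  ∈-colourClass⁻ : ∀ {k} {c : Fin n → Fin k} {i v} → v ∈ colourClass G c i → c v ≡ i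
  ∈-colourClass⁻ {c = c} {i} {v} v∈ =
    toWitness (Equivalence.from T-≡ (trans (≡.sym (lookup∘tabulate _ v)) ([]=⇒lookup v∈)))

  ∈-colourClass⁺ : ∀ {k} {c : Fin n → Fin k} {i v} → c v ≡ i → v ∈ colourClass G c i
  ∈-colourClass⁺ {c = c} {i} {v} cv≡i =
    lookup⇒[]= v _ (trans (lookup∘tabulate _ v) (Equivalence.to T-≡ (fromWitness cv≡i)))

  cover⇒colouring : ∀ {K} → IMVCover U K → ∃[ c ] IsIMVColouring G K c
  cover⇒colouring {K} C = colour , λ i → IsIMVᵖ-⊆ (class⊆block i) (block-IMV C i)
    where
    colour : Fin n → Fin K
    colour v = proj₁ (covered C _)

    class⊆block : ∀ i → (_∈ colourClass G colour i) ⊆ block C i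
    class⊆block i {v} v∈ = subst (λ j → block C j v) (∈-colourClass⁻ v∈) (proj₂ (covered C _))

  singletonsᶜ : IMVCover U n
  singletonsᶜ = record { block = λ i → _∈ₗ [ i ] ; block-IMV = singleton-isIMV ; covered = λ {v} _ → v , here refl }

  adjacent⇒distinctColours : ∀ {k} (c : Fin n → Fin k) → IsIMVColouring G k c → ∀ {x y} → Adj x y → c x ≢ c y
  adjacent⇒distinctColours c c-IMV {x} {y} xy cx≡cy =
    ≡false⇒¬Adj (proj₁ (c-IMV (c y)) x y (∈-colourClass⁺ cx≡cy) (∈-colourClass⁺ refl)) xy

  χ≤cover : ∀ {k K} → IsChiMuI G k → IMVCover U K → k ≤ K
  χ≤cover {K = K} (_ , minimal) C = let (c , c-IMV) = cover⇒colouring C in minimal K c c-IMV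

  neighbourOutside : Connected G → ∀ {X u w} → Independent G X → u ∉ X → w ∈ X → ∃[ y ] Adj w y × y ∉ X
  neighbourOutside connected {u = u} {w} X-independent u∉X w∈X with connected w u
  ... | []                = contradiction w∈X u∉X
  ... | _∷_ {y = y} wy _ = y , wy , λ y∈X → ≡false⇒¬Adj (X-independent w y w∈X y∈X) wy

  IMVSet∷ᶜ : ∀ {X P K} → IsIMV G X → (∀ {v} → v ∉ X → P v) → IMVCover P K → IMVCover U (suc K)
  IMVSet∷ᶜ {X} {P} X-IMV ∁X⊆P C = IMVCover-⊆ split (X-IMV ∷ᶜ C)
    where
    split : U ⊆ (_∈ X) ∪ P
    split {v} _ with v ∈? X
    ... | yes v∈X = inj₁ v∈X
    ... | no  v∉X = inj₂ (∁X⊆P v∉X)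

  module _ (connected : Connected G) where

    pair∷ᶜ : ∀ {a b R K} → adj G a b ≡ false → IMVCover (_∈ₗ R) K → IMVCover (_∈ₗ a ∷ b ∷ R) (suc K)
    pair∷ᶜ {a} {b} a≁b C = IMVCover-⊆ (∈-++⁻ (a ∷ b ∷ [])) (pair-isIMV connected a≁b ∷ᶜ C)

  module _ (triangleFree : TriangleFree G) where

    nonadjacentPair : ∀ x y z → ∃[ a ] ∃[ b ] ∃[ t ] adj G a b ≡ false × x ∷ y ∷ z ∷ [] ↭ a ∷ b ∷ t ∷ []
    nonadjacentPair x y z with adj G x y in xy | adj G y z in yz | adj G x z in xz
    ... | false | _     | _     = x , y , z , xy , ↭-refl
    ... | _     | false | _     = y , z , x , yz , ↭-trans (swap x y ↭-refl) (prep y (swap x z ↭-refl))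
    ... | _     | _     | false = x , z , y , xz , prep x (swap y z ↭-refl)
    ... | true  | true  | true  = ⊥-elim (triangleFree x y z xy yz xz)

    starᶜ : ∀ {R} u → (∀ {v} → v ∈ₗ R → Adj v u ⊎ v ≡ u) → IMVCover (_∈ₗ R) 2
    starᶜ u R⊆star = IMVCover-⊆ (map₂ here ∘ R⊆star) (nbhd-isIMV triangleFree u ∷ᶜ singletonᶜ u)

    dominatingPairᶜ : ∀ x y → (∀ v → ∃[ r ] Adj v r × r ∈ₗ x ∷ y ∷ []) → IMVCover U 2
    dominatingPairᶜ x y dominated =
      IMVCover-⊆ toBlock (nbhd-isIMV triangleFree x ∷ᶜ nbhd-isIMV triangleFree y ∷ᶜ []ᶜ)
      where
      toBlock : U ⊆ Nbhd x ∪ (Nbhd y ∪ (_∈ₗ []))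
      toBlock {v} _ with dominated v
      ... | _ , vx , here refl         = inj₁ vx
      ... | _ , vy , there (here refl) = inj₂ (inj₁ vy)

  module _ (connected : Connected G) (triangleFree : TriangleFree G) where

    -- Once u ~ w, triangle-freeness leaves each of a, b adjacent to at most one of u, w.
    fourᶜ : ∀ {a b} → adj G a b ≡ false → ∀ u w → IMVCover (_∈ₗ a ∷ b ∷ u ∷ w ∷ []) 2
    fourᶜ {a} {b} a≁b u w with adj G u w in uw
    ... | false = pair∷ᶜ connected a≁b (pair∷ᶜ connected uw []ᶜ)
    ... | true with adj G a u in au | adj G b w in bw | adj G a w in aw | adj G b u in bu
    ... | false | false | _     | _     =
      IMVCover-↭ (prep a (swap b u ↭-refl)) (pair∷ᶜ connected au (pair∷ᶜ connected bw []ᶜ))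
    ... | true  | _     | true  | _     = ⊥-elim (triangleFree a u w au uw aw)
    ... | _     | true  | _     | true  = ⊥-elim (triangleFree b u w bu uw bw)
    ... | _     | _     | false | false =
      IMVCover-↭ (prep a (↭-trans (prep b (swap u w ↭-refl)) (swap b w ↭-refl)))
                 (pair∷ᶜ connected aw (pair∷ᶜ connected bu []ᶜ))
    ... | true  | _     | _     | true  = starᶜ triangleFree u λ
      { (here refl) → inj₁ au ; (there (here refl)) → inj₁ bu
      ; (there (there (here refl))) → inj₂ refl ; (there (there (there (here refl)))) → inj₁ (adj-sym uw) }
    ... | _     | true  | true  | _     = starᶜ triangleFree w λ
      { (here refl) → inj₁ aw ; (there (here refl)) → inj₁ bw
      ; (there (there (here refl))) → inj₁ uw ; (there (there (there (here refl)))) → inj₂ refl }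

    -- Splitting off a pair typechecks because ⌈ 2 + r /2⌉ reduces to suc ⌈ r /2⌉.
    mutual
      atLeastThreeᶜ : ∀ x y z rs → IMVCover (_∈ₗ x ∷ y ∷ z ∷ rs) ⌈ 3 + length rs /2⌉
      atLeastThreeᶜ x y z rs with nonadjacentPair triangleFree x y z
      ... | a , b , t , a≁b , xyz↭abt = IMVCover-↭ (++⁺ʳ rs xyz↭abt) (nonadjacentPair∷ᶜ a≁b t rs)

      nonadjacentPair∷ᶜ : ∀ {a b} → adj G a b ≡ false →
                          ∀ t rs → IMVCover (_∈ₗ a ∷ b ∷ t ∷ rs) ⌈ 3 + length rs /2⌉
      nonadjacentPair∷ᶜ a≁b t []             = pair∷ᶜ connected a≁b (singletonᶜ t)
      nonadjacentPair∷ᶜ a≁b t (w ∷ [])       = fourᶜ a≁b t w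
      nonadjacentPair∷ᶜ a≁b t (w₁ ∷ w₂ ∷ rs) = pair∷ᶜ connected a≁b (atLeastThreeᶜ t w₁ w₂ rs)

    coverAroundIMV : ∀ {X} → IsIMV G X → ∀ R → (∀ {v} → v ∉ X → v ∈ₗ R) → (∀ {v} → v ∈ₗ R → v ∉ X) →
                     IMVCover U (suc ⌈ length R /2⌉)
    coverAroundIMV X-IMV []               ∁X⊆R _ = IMVSet∷ᶜ X-IMV ∁X⊆R []ᶜ
    coverAroundIMV X-IMV (x ∷ [])         ∁X⊆R _ = IMVSet∷ᶜ X-IMV ∁X⊆R (singletonᶜ x)
    coverAroundIMV X-IMV (x ∷ y ∷ z ∷ rs) ∁X⊆R _ = IMVSet∷ᶜ X-IMV ∁X⊆R (atLeastThreeᶜ x y z rs)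
    coverAroundIMV {X} X-IMV (x ∷ y ∷ []) ∁X⊆R R⊆∁X with adj G x y in xy
    ... | false = IMVSet∷ᶜ X-IMV ∁X⊆R (pair∷ᶜ connected xy []ᶜ)
    ... | true  = dominatingPairᶜ triangleFree x y dominated
      where
      dominated : ∀ v → ∃[ r ] Adj v r × r ∈ₗ x ∷ y ∷ []
      dominated v with v ∈? X
      ... | yes v∈X = let (r , vr , r∉X) = neighbourOutside connected (proj₁ X-IMV) (R⊆∁X (here refl)) v∈X
                      in r , vr , ∁X⊆R r∉X
      ... | no  v∉X with ∁X⊆R v∉X
      ...   | here refl         = y , xy , there (here refl)
      ...   | there (here refl) = x , adj-sym xy , here refl

upperBound : (G : Graph n) → Connected G → TriangleFree G →
             ∀ {m k} → IsMuI G m → IsChiMuI G k → k ≤ ⌈ n ∸ m /2⌉ + 1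
upperBound {n} G connected triangleFree {k = k} ((X , X-IMV , refl) , _) χ = begin
  k                     ≤⟨ χ≤cover G χ R-cover ⟩
  suc ⌈ length R /2⌉   ≡⟨ cong (λ r → suc ⌈ r /2⌉) (trans (length-elements (∁ X)) (∣∁p∣≡n∸∣p∣ X)) ⟩
  suc ⌈ n ∸ ∣ X ∣ /2⌉  ≡⟨ +-comm 1 _ ⟩
  ⌈ n ∸ ∣ X ∣ /2⌉ + 1  ∎
  where
  open ≤-Reasoning
  R : List (Fin n)
  R = elements (∁ X)

  R-cover : IMVCover G U (suc ⌈ length R /2⌉)
  R-cover = coverAroundIMV G connected triangleFree X-IMV R
              (∈⇒∈-elements ∘ x∉p⇒x∈∁p) (x∈∁p⇒x∉p ∘ ∈-elements⇒∈)

K₂ : Graph 2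
K₂ = record { adj = edge ; sym = edge-sym ; irrefl = edge-irrefl }
  where
  edge : Fin 2 → Fin 2 → Bool
  edge zero       zero       = false
  edge zero       (suc zero) = true
  edge (suc zero) zero       = true
  edge (suc zero) (suc zero) = false

  edge-sym : ∀ x y → edge x y ≡ edge y x
  edge-sym zero       zero       = refl
  edge-sym zero       (suc zero) = refl
  edge-sym (suc zero) zero       = refl
  edge-sym (suc zero) (suc zero) = refl

  edge-irrefl : ∀ x → edge x x ≡ false
  edge-irrefl zero       = refl
  edge-irrefl (suc zero) = refl

K₂-connected : Connected K₂
K₂-connected zero       zero       = []
K₂-connected zero       (suc zero) = refl ∷ []
K₂-connected (suc zero) zero       = refl ∷ []
K₂-connected (suc zero) (suc zero) = []

K₂-triangleFree : TriangleFree K₂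
K₂-triangleFree zero       zero       _          () _  _
K₂-triangleFree (suc zero) (suc zero) _          () _  _
K₂-triangleFree zero       (suc zero) zero       _  _  ()
K₂-triangleFree zero       (suc zero) (suc zero) _  () _
K₂-triangleFree (suc zero) zero       zero       _  () _
K₂-triangleFree (suc zero) zero       (suc zero) _  _  ()

K₂-independent⇒∣∣≤1 : ∀ X → Independent K₂ X → ∣ X ∣ ≤ 1
K₂-independent⇒∣∣≤1 (outside ∷ outside ∷ []) _ = z≤n
K₂-independent⇒∣∣≤1 (outside ∷ inside  ∷ []) _ = ≤-refl
K₂-independent⇒∣∣≤1 (inside  ∷ outside ∷ []) _ = ≤-refl
K₂-independent⇒∣∣≤1 (inside  ∷ inside  ∷ []) independent
  with () ← independent zero (suc zero) Vec.here (Vec.there Vec.here)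

K₂-μᵢ : IsMuI K₂ 1
K₂-μᵢ = (⁅ zero ⁆ , IsIMVᵖ-⊆ K₂ (here ∘ x∈⁅y⁆⇒x≡y zero) (singleton-isIMV K₂ zero) , refl)
      , λ X X-IMV → K₂-independent⇒∣∣≤1 X (proj₁ X-IMV)

K₂-χμᵢ : IsChiMuI K₂ 2
K₂-χμᵢ = cover⇒colouring K₂ (singletonsᶜ K₂)
       , λ _ c c-IMV → distinct⇒2≤ (adjacent⇒distinctColours K₂ c c-IMV {zero} {suc zero} refl)

theorem4p1 : (∀ (n : ℕ) (G : Graph n) → 2 ≤ n → Connected G → TriangleFree G →
                ∀ (m k : ℕ) → IsMuI G m → IsChiMuI G k → k ≤ ⌈ n ∸ m /2⌉ + 1)
             × (∃[ n ] Σ (Graph n) λ G → 2 ≤ n × Connected G × TriangleFree G ×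
                (∃[ m ] ∃[ k ] IsMuI G m × IsChiMuI G k × k ≡ ⌈ n ∸ m /2⌉ + 1))
theorem4p1 = (λ _ G _ connected triangleFree _ _ → upperBound G connected triangleFree)
           , 2 , K₂ , ≤-refl , K₂-connected , K₂-triangleFree , 1 , 2 , K₂-μᵢ , K₂-χμᵢ , refl
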